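{- Let $G$ be a graph with $k=\chi(G)$ which can be properly $k$-coloured in exactly two ways up to permuting colours (i.e. $V(G)$ has exactly two partitions into $k$ independent sets). Then for every proper $k$-colouring $c$ of $G$ there exists a critical set for $(G,c)$ of cardinality $\chi(G)$.
   Context: For a graph $G=(V,E)$ and $k=\chi(G)$, a proper $k$-colouring is a map $c\colon V\to\{1,\dots,k\}$ with adjacent vertices receiving different colours. A determining set for $(G,c)$ is a set $S\subseteq V$ such that no proper $k$-colouring $c'\neq c$ satisfies $c'(s)=c(s)$ for all $s\in S$; a critical set is an inclusion-minimal determining set. -}

module Defs where

open import Data.Nat using (ℕ; _<_)
open import Data.Fin using (Fin)
open import Data.Fin.Subset using (Subset; _∈_; _⊆_; _⊂_; ∣_∣)
open import Data.Product using (Σ; ∃; _×_; _,_)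
open import Relation.Nullary using (¬_)
open import Relation.Binary.PropositionalEquality using (_≡_; _≢_)
open import Function.Bundles using (_↔_; Inverse)
open import Data.Sum using (_⊎_)
open import Level using (0ℓ; suc)

record Graph (n : ℕ) : Set₁ where
  field
    Adj   : Fin n → Fin n → Set
    sym   : ∀ {u v} → Adj u v → Adj v u
    irrefl : ∀ {u} → ¬ Adj u u

open Graph public

Colouring : ℕ → ℕ → Set
Colouring n k = Fin n → Fin k

Proper : ∀ {n k} → Graph n → Colouring n k → Set
Proper G c = ∀ {u v} → Adj G u v → c u ≢ c v

Colourable : ∀ {n} → Graph n → ℕ → Set
Colourable {n} G k = Σ (Colouring n k) (Proper G)

IsChromaticNumber : ∀ {n} → Graph n → ℕ → Set
IsChromaticNumber G k = Colourable G k × (∀ j → j < k → ¬ Colourable G j)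

SamePartition : ∀ {n k} → Colouring n k → Colouring n k → Set
SamePartition {n} {k} c c' =
  Σ (Fin k ↔ Fin k) λ π → ∀ v → c' v ≡ Inverse.to π (c v)

ExactlyTwoColourings : ∀ {n} → Graph n → ℕ → Set
ExactlyTwoColourings {n} G k =
  Σ (Colouring n k) λ c₁ → Σ (Colouring n k) λ c₂ →
    Proper G c₁ × Proper G c₂ × ¬ SamePartition c₁ c₂ ×
    (∀ c → Proper G c → SamePartition c₁ c ⊎ SamePartition c₂ c)

Determining : ∀ {n k} → Graph n → Colouring n k → Subset n → Set
Determining {n} {k} G c S =
  ∀ (c' : Colouring n k) → Proper G c' → (∀ s → s ∈ S → c' s ≡ c s) → ∀ v → c' v ≡ c v

Critical : ∀ {n k} → Graph n → Colouring n k → Subset n → Set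
Critical G c S = Determining G c S × (∀ T → T ⊂ S → ¬ Determining G c T)

-- Let d be a proper k-colouring inducing the other partition. Join colour x of c to
-- colour y of d when some vertex receives both: a vertex cover of this bipartite graph
-- with j vertices yields a proper j-colouring of G, so as χ(G) = k König's theorem gives
-- a perfect matching σ, and each matched pair of colours has a representative vertex.
-- Since c and d induce different partitions, some vertex v₀ has d v₀ ≠ σ (c v₀); replace
-- the representative of y = σ⁻¹ (d v₀) by v₀. These k vertices determine c: a relabelling
-- of c agreeing with c on them fixes every colour but y, hence all colours, and no
-- relabelling of d agrees with c on them, because v₀ and the representative of c v₀
-- share their c-colour but not their d-colour. Dropping any one of them is witnessed to
-- lose this by σ⁻¹ ∘ d, by a transposition of it, or by a transposition of c.

module Submission where

open import Defs hiding (sym)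
open import Data.Nat using (ℕ; zero; suc; _+_; _∸_; _≤_; _<_; _≤?_; _<?_; s≤s⁻¹)
open import Data.Nat.Properties
  using (≤-antisym; <-≤-trans; ≤⇒≯; ≮⇒≥; 1+n≰n; n<1+n; m≤m+n; +-suc; +-comm; +-mono-≤; +-monoʳ-≤; +-monoˡ-≤; +-identityʳ; module ≤-Reasoning)
open import Data.Nat.Tactic.RingSolver using (solve-∀)
open import Data.Fin using (Fin; zero; suc; join; splitAt; punchOut)
open import Data.Fin.Properties using (_≟_; any?; all?; suc-injective; splitAt-join; punchOut-injective; injective⇒≤; ¬∀⟶∃¬)
open import Data.Fin.Subset using (Subset; _∈_; _∉_; _⊆_; _⊂_; ∣_∣; inside; outside; _∪_; _∩_; ⁅_⁆; ∁; _-_) renaming (⊥ to ∅)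
open import Data.Fin.Subset.Properties
  using (_∈?_; anySubset?; p─q⊆p; x∈p⇒∣p-x∣<∣p∣; x∈p∧x≢y⇒x∈p-y; ∣∁p∣≡n∸∣p∣; ∣⁅x⁆∣≡1; ∣⊥∣≡0; x∈⁅x⁆; x≢y⇒x∉⁅y⁆; x∉p⇒x∈∁p; x∈p∪q⁺; x∈p∩q⁺)
open import Data.Fin.Permutation using (Permutation′; permutation; transpose; flip; _∘ₚ_; _⟨$⟩ʳ_; _⟨$⟩ˡ_; inverseˡ; inverseʳ)
open import Data.Vec using ([]; _∷_; tabulate; here; there)
open import Data.Vec.Properties using ([]=⇒lookup; lookup⇒[]=; lookup∘tabulate)
open import Data.Vec.Functional using (updateAt)
open import Data.Vec.Functional.Properties using (updateAt-updates; updateAt-minimal)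
open import Data.List using (List; []; _∷_; allFin)
open import Data.List.Membership.Propositional using () renaming (_∈_ to _∈ₗ_)
open import Data.List.Membership.Propositional.Properties using (∈-allFin)
open import Data.List.Relation.Unary.Any using () renaming (here to hereₗ; there to thereₗ)
open import Data.Product using (Σ; ∃; ∃₂; _×_; _,_; proj₁; proj₂)
open import Data.Sum using (_⊎_; inj₁; inj₂; map; map₁; map₂; swap)
open import Data.Sum.Properties using (inj₁-injective; inj₂-injective)
open import Data.Empty using (⊥-elim)
open import Function using (_∘_)
open import Function.Bundles using (Injection)
open import Function.Definitions using (Injective)
open import Function.Properties.Inverse using (↔⇒↣)
open import Relation.Nullary using (Dec; yes; no; does; ¬_; contradiction)
open import Relation.Nullary.Decidable using (_×-dec_; _⊎-dec_; _→-dec_; ¬?; dec-true; dec-false)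
open import Relation.Unary using (Decidable)
open import Relation.Binary.PropositionalEquality using (_≡_; _≢_; refl; sym; trans; cong; cong₂; subst; module ≡-Reasoning)

private
  variable
    m n k l : ℕ

-- Subsets of Fin n

index : ∀ {p : Subset n} {x} → x ∈ p → Fin ∣ p ∣
index {p = inside ∷ p} here = zero
index {p = inside ∷ p} (there x∈p) = suc (index x∈p)
index {p = outside ∷ p} (there x∈p) = index x∈p

index-injective : ∀ {p : Subset n} {x y} (x∈p : x ∈ p) (y∈p : y ∈ p) → index x∈p ≡ index y∈p → x ≡ y
index-injective {p = inside ∷ p} here here _ = refl
index-injective {p = inside ∷ p} (there x∈p) (there y∈p) eq = cong suc (index-injective x∈p y∈p (suc-injective eq))
index-injective {p = outside ∷ p} (there x∈p) (there y∈p) eq = cong suc (index-injective x∈p y∈p eq)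

member : (p : Subset n) → Fin ∣ p ∣ → Fin n
member (inside ∷ p) zero = zero
member (inside ∷ p) (suc i) = suc (member p i)
member (outside ∷ p) i = suc (member p i)

member∈ : (p : Subset n) (i : Fin ∣ p ∣) → member p i ∈ p
member∈ (inside ∷ p) zero = here
member∈ (inside ∷ p) (suc i) = there (member∈ p i)
member∈ (outside ∷ p) i = there (member∈ p i)

member-injective : (p : Subset n) → Injective _≡_ _≡_ (member p)
member-injective (inside ∷ p) {zero} {zero} _ = refl
member-injective (inside ∷ p) {suc i} {suc j} eq = cong suc (member-injective p (suc-injective eq))
member-injective (outside ∷ p) eq = member-injective p (suc-injective eq)

select : ∀ {P : Fin n → Set} → Decidable P → Subset n
select P? = tabulate (does ∘ P?)

∈-select⁺ : ∀ {P : Fin n → Set} (P? : Decidable P) {x} → P x → x ∈ select P?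
∈-select⁺ P? {x} px = lookup⇒[]= x _ (trans (lookup∘tabulate _ x) (dec-true (P? x) px))

∈-select⁻ : ∀ {P : Fin n → Set} (P? : Decidable P) {x} → x ∈ select P? → P x
∈-select⁻ P? {x} x∈ with P? x | trans (sym (lookup∘tabulate _ x)) ([]=⇒lookup x∈)
... | yes px | _ = px

inImage? : (f : Fin m → Fin n) → Decidable (λ y → ∃ λ x → f x ≡ y)
inImage? f y = any? (λ x → f x ≟ y)

image : (Fin m → Fin n) → Subset n
image f = select (inImage? f)

∈-image⁺ : (f : Fin m → Fin n) (x : Fin m) → f x ∈ image f
∈-image⁺ f x = ∈-select⁺ (inImage? f) (x , refl)

∈-image⁻ : (f : Fin m → Fin n) {y : Fin n} → y ∈ image f → ∃ λ x → f x ≡ y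
∈-image⁻ f = ∈-select⁻ (inImage? f)

injective⇒∣image∣≡m : {f : Fin m → Fin n} → Injective _≡_ _≡_ f → ∣ image f ∣ ≡ m
injective⇒∣image∣≡m {m} {f = f} f-inj = ≤-antisym (injective⇒≤ preimage-injective) (injective⇒≤ index-image-injective)
  where
  preimage : Fin ∣ image f ∣ → Fin m
  preimage i = proj₁ (∈-image⁻ f (member∈ (image f) i))
  preimage-injective : Injective _≡_ _≡_ preimage
  preimage-injective {i} {j} eq = member-injective (image f)
    (trans (sym (proj₂ (∈-image⁻ f (member∈ (image f) i))))
      (trans (cong f eq) (proj₂ (∈-image⁻ f (member∈ (image f) j)))))
  index-image-injective : Injective _≡_ _≡_ (λ x → index (∈-image⁺ f x))
  index-image-injective eq = f-inj (index-injective (∈-image⁺ f _) (∈-image⁺ f _) eq)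

∣p∪q∣+∣p∩q∣≡∣p∣+∣q∣ : (p q : Subset n) → ∣ p ∪ q ∣ + ∣ p ∩ q ∣ ≡ ∣ p ∣ + ∣ q ∣
∣p∪q∣+∣p∩q∣≡∣p∣+∣q∣ [] [] = refl
∣p∪q∣+∣p∩q∣≡∣p∣+∣q∣ (inside ∷ p) (inside ∷ q) = cong suc (begin
  ∣ p ∪ q ∣ + suc ∣ p ∩ q ∣ ≡⟨ +-suc ∣ p ∪ q ∣ ∣ p ∩ q ∣ ⟩
  suc (∣ p ∪ q ∣ + ∣ p ∩ q ∣) ≡⟨ cong suc (∣p∪q∣+∣p∩q∣≡∣p∣+∣q∣ p q) ⟩
  suc (∣ p ∣ + ∣ q ∣) ≡⟨ +-suc ∣ p ∣ ∣ q ∣ ⟨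
  ∣ p ∣ + suc ∣ q ∣ ∎)
  where open ≡-Reasoning
∣p∪q∣+∣p∩q∣≡∣p∣+∣q∣ (inside ∷ p) (outside ∷ q) = cong suc (∣p∪q∣+∣p∩q∣≡∣p∣+∣q∣ p q)
∣p∪q∣+∣p∩q∣≡∣p∣+∣q∣ (outside ∷ p) (inside ∷ q) = trans (cong suc (∣p∪q∣+∣p∩q∣≡∣p∣+∣q∣ p q)) (sym (+-suc ∣ p ∣ ∣ q ∣))
∣p∪q∣+∣p∩q∣≡∣p∣+∣q∣ (outside ∷ p) (outside ∷ q) = ∣p∪q∣+∣p∩q∣≡∣p∣+∣q∣ p q

∣p∪⁅x⁆∣≤1+∣p∣ : (p : Subset n) (x : Fin n) → ∣ p ∪ ⁅ x ⁆ ∣ ≤ suc ∣ p ∣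
∣p∪⁅x⁆∣≤1+∣p∣ p x = begin
  ∣ p ∪ ⁅ x ⁆ ∣                  ≤⟨ m≤m+n _ _ ⟩
  ∣ p ∪ ⁅ x ⁆ ∣ + ∣ p ∩ ⁅ x ⁆ ∣ ≡⟨ ∣p∪q∣+∣p∩q∣≡∣p∣+∣q∣ p ⁅ x ⁆ ⟩
  ∣ p ∣ + ∣ ⁅ x ⁆ ∣              ≡⟨ cong (∣ p ∣ +_) (∣⁅x⁆∣≡1 x) ⟩
  ∣ p ∣ + 1                      ≡⟨ +-comm ∣ p ∣ 1 ⟩
  suc ∣ p ∣                      ∎
  where open ≤-Reasoning

∣∁⁅x⁆∣<n : (x : Fin n) → ∣ ∁ ⁅ x ⁆ ∣ < n
∣∁⁅x⁆∣<n {suc n} x = begin-strict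
  ∣ ∁ ⁅ x ⁆ ∣           ≡⟨ ∣∁p∣≡n∸∣p∣ ⁅ x ⁆ ⟩
  suc n ∸ ∣ ⁅ x ⁆ ∣     ≡⟨ cong (suc n ∸_) (∣⁅x⁆∣≡1 x) ⟩
  n                     <⟨ n<1+n n ⟩
  suc n                 ∎
  where open ≤-Reasoning

+<+⇒<⊎< : ∀ {a b k} → a + b < k + k → a < k ⊎ b < k
+<+⇒<⊎< {a} {b} {k} a+b<k+k with a <? k | b <? k
... | yes a<k | _       = inj₁ a<k
... | no _    | yes b<k = inj₂ b<k
... | no a≮k  | no b≮k  = contradiction a+b<k+k (≤⇒≯ (+-mono-≤ (≮⇒≥ a≮k) (≮⇒≥ b≮k)))

-- Permutations of Fin n

permutation-injective : (π : Permutation′ n) → Injective _≡_ _≡_ (π ⟨$⟩ʳ_)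
permutation-injective π = Injection.injective (↔⇒↣ π)

injective⇒surjective : {f : Fin n → Fin n} → Injective _≡_ _≡_ f → ∀ y → ∃ λ x → f x ≡ y
injective⇒surjective {zero} _ ()
injective⇒surjective {suc n} {f} f-inj y with any? (λ x → f x ≟ y)
... | yes hit = hit
... | no miss = contradiction (injective⇒≤ avoid-y-injective) (1+n≰n {n})
  where
  avoid-y : Fin (suc n) → Fin n
  avoid-y x = punchOut (miss ∘ (x ,_) ∘ sym)
  avoid-y-injective : Injective _≡_ _≡_ avoid-y
  avoid-y-injective eq = f-inj (punchOut-injective (miss ∘ (_ ,_) ∘ sym) (miss ∘ (_ ,_) ∘ sym) eq)

injection⇒permutation : (f : Fin n → Fin n) → Injective _≡_ _≡_ f → Permutation′ n
injection⇒permutation {n} f f-inj = permutation f f⁻¹ (λ y → proj₂ (f-surj y)) (λ x → f-inj (proj₂ (f-surj (f x))))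
  where
  f-surj : ∀ y → ∃ λ x → f x ≡ y
  f-surj = injective⇒surjective f-inj
  f⁻¹ : Fin n → Fin n
  f⁻¹ y = proj₁ (f-surj y)

fixes-all-but-one⇒fixes-all : (π : Permutation′ n) (y : Fin n) →
  (∀ x → x ≢ y → π ⟨$⟩ʳ x ≡ x) → ∀ x → π ⟨$⟩ʳ x ≡ x
fixes-all-but-one⇒fixes-all π y fixes x with x ≟ y
... | no x≢y = fixes x x≢y
... | yes refl with π ⟨$⟩ʳ x ≟ x
...   | yes πx≡x = πx≡x
...   | no πx≢x = contradiction (permutation-injective π (fixes (π ⟨$⟩ʳ x) πx≢x)) πx≢x

transpose-matchˡ : (i j : Fin n) → transpose i j ⟨$⟩ʳ i ≡ j
transpose-matchˡ i j rewrite dec-true (i ≟ i) refl = refl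

transpose-matchʳ : (i j : Fin n) → transpose i j ⟨$⟩ʳ j ≡ i
transpose-matchʳ i j with j ≟ i
... | yes refl = refl
... | no _ rewrite dec-true (j ≟ j) refl = refl

transpose-other : {i j x : Fin n} → x ≢ i → x ≢ j → transpose i j ⟨$⟩ʳ x ≡ x
transpose-other {i = i} {j} {x} x≢i x≢j rewrite dec-false (x ≟ i) x≢i | dec-false (x ≟ j) x≢j = refl

-- König's theorem

BipartiteGraph : ℕ → ℕ → Set
BipartiteGraph m n = Fin m → Subset n

Covers : BipartiteGraph m n → Subset m → Subset n → Set
Covers N A B = ∀ x y → y ∈ N x → x ∈ A ⊎ y ∈ B

SmallCover : BipartiteGraph m n → Set
SmallCover {m} N = ∃₂ λ A B → Covers N A B × ∣ A ∣ + ∣ B ∣ < m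

NoSmallCover : BipartiteGraph m n → Set
NoSmallCover N = ¬ SmallCover N

smallCover? : (N : BipartiteGraph m n) → Dec (SmallCover N)
smallCover? {m} N = anySubset? λ A → anySubset? λ B →
  all? (λ x → all? λ y → y ∈? N x →-dec (x ∈? A ⊎-dec y ∈? B)) ×-dec suc (∣ A ∣ + ∣ B ∣) ≤? m

_⊑_ : BipartiteGraph m n → BipartiteGraph m n → Set
N′ ⊑ N = ∀ x → N′ x ⊆ N x

deleteEdge : BipartiteGraph m n → Fin m → Fin n → BipartiteGraph m n
deleteEdge N x y = updateAt N x (_- y)

deleteEdge-⊑ : (N : BipartiteGraph m n) (x : Fin m) (y : Fin n) → deleteEdge N x y ⊑ N
deleteEdge-⊑ N x y x′ with x′ ≟ x
... | yes refl = subst (_⊆ N x) (sym (updateAt-updates x N)) (p─q⊆p (N x) ⁅ y ⁆)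
... | no x′≢x = subst (_⊆ N x′) (sym (updateAt-minimal x′ x N x′≢x)) (λ y∈ → y∈)

∣deleteEdge∣< : (N : BipartiteGraph m n) {x : Fin m} {y : Fin n} → y ∈ N x → ∣ deleteEdge N x y x ∣ < ∣ N x ∣
∣deleteEdge∣< N {x} y∈Nx = subst (λ p → ∣ p ∣ < ∣ N x ∣) (sym (updateAt-updates x N)) (x∈p⇒∣p-x∣<∣p∣ y∈Nx)

∈-deleteEdge : (N : BipartiteGraph m n) {x x′ : Fin m} {y y′ : Fin n} →
  y′ ∈ N x′ → (x′ ≡ x → y′ ≢ y) → y′ ∈ deleteEdge N x y x′
∈-deleteEdge N {x} {x′} y′∈ other with x′ ≟ x
... | yes refl = subst (_ ∈_) (sym (updateAt-updates x N)) (x∈p∧x≢y⇒x∈p-y y′∈ (other refl))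
... | no x′≢x = subst (_ ∈_) (sym (updateAt-minimal x′ x N x′≢x)) y′∈

covers-deleteEdge : (N : BipartiteGraph m n) {x : Fin m} {y : Fin n} {A : Subset m} {B : Subset n} →
  Covers (deleteEdge N x y) A B → x ∈ A → Covers N A B
covers-deleteEdge N {x} cov x∈A x′ y′ y′∈ with x′ ≟ x
... | yes refl = inj₁ x∈A
... | no x′≢x = cov x′ y′ (∈-deleteEdge N y′∈ (⊥-elim ∘ x′≢x))

covers-∩∪ : (N : BipartiteGraph m n) {x : Fin m} {y₁ y₂ : Fin n} {A₁ A₂ : Subset m} {B₁ B₂ : Subset n} →
  x ∉ A₁ → x ∉ A₂ → y₁ ≢ y₂ → Covers (deleteEdge N x y₁) A₁ B₁ → Covers (deleteEdge N x y₂) A₂ B₂ →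
  Covers N (A₁ ∩ A₂) (B₁ ∪ B₂)
covers-∩∪ N {x} {y₁} x∉A₁ x∉A₂ y₁≢y₂ cov₁ cov₂ x′ y′ y′∈ with x′ ≟ x | y′ ≟ y₁
... | yes refl | yes refl with cov₂ _ _ (∈-deleteEdge N y′∈ (λ _ → y₁≢y₂))
...   | inj₁ x∈A₂ = ⊥-elim (x∉A₂ x∈A₂)
...   | inj₂ y₁∈B₂ = inj₂ (x∈p∪q⁺ (inj₂ y₁∈B₂))
covers-∩∪ N x∉A₁ x∉A₂ y₁≢y₂ cov₁ cov₂ x′ y′ y′∈ | yes refl | no y′≢y₁ with cov₁ x′ y′ (∈-deleteEdge N y′∈ (λ _ → y′≢y₁))
... | inj₁ x∈A₁ = ⊥-elim (x∉A₁ x∈A₁)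
... | inj₂ y′∈B₁ = inj₂ (x∈p∪q⁺ (inj₁ y′∈B₁))
covers-∩∪ N x∉A₁ x∉A₂ y₁≢y₂ cov₁ cov₂ x′ y′ y′∈ | no x′≢x | _
  with cov₁ x′ y′ (∈-deleteEdge N y′∈ (⊥-elim ∘ x′≢x)) | cov₂ x′ y′ (∈-deleteEdge N y′∈ (⊥-elim ∘ x′≢x))
... | inj₁ x′∈A₁ | inj₁ x′∈A₂ = inj₁ (x∈p∩q⁺ (x′∈A₁ , x′∈A₂))
... | inj₂ y′∈B₁ | _          = inj₂ (x∈p∪q⁺ (inj₁ y′∈B₁))
... | inj₁ _     | inj₂ y′∈B₂ = inj₂ (x∈p∪q⁺ (inj₂ y′∈B₂))

covers-∪∩ : (N : BipartiteGraph m n) {x : Fin m} {y₁ y₂ : Fin n} {A₁ A₂ : Subset m} {B₁ B₂ : Subset n} →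
  Covers (deleteEdge N x y₁) A₁ B₁ → Covers (deleteEdge N x y₂) A₂ B₂ →
  Covers N ((A₁ ∪ A₂) ∪ ⁅ x ⁆) (B₁ ∩ B₂)
covers-∪∩ N {x} cov₁ cov₂ x′ y′ y′∈ with x′ ≟ x
... | yes refl = inj₁ (x∈p∪q⁺ (inj₂ (x∈⁅x⁆ x)))
... | no x′≢x with cov₁ x′ y′ (∈-deleteEdge N y′∈ (⊥-elim ∘ x′≢x)) | cov₂ x′ y′ (∈-deleteEdge N y′∈ (⊥-elim ∘ x′≢x))
...   | inj₁ x′∈A₁ | _          = inj₁ (x∈p∪q⁺ (inj₁ (x∈p∪q⁺ (inj₁ x′∈A₁))))
...   | inj₂ _     | inj₁ x′∈A₂ = inj₁ (x∈p∪q⁺ (inj₁ (x∈p∪q⁺ (inj₂ x′∈A₂))))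
...   | inj₂ y′∈B₁ | inj₂ y′∈B₂ = inj₂ (x∈p∩q⁺ (y′∈B₁ , y′∈B₂))

uncrossed-covers-size : (x : Fin m) (A₁ A₂ : Subset m) (B₁ B₂ : Subset n) →
  ∣ A₁ ∣ + ∣ B₁ ∣ < m → ∣ A₂ ∣ + ∣ B₂ ∣ < m →
  (∣ A₁ ∩ A₂ ∣ + ∣ B₁ ∪ B₂ ∣) + (∣ (A₁ ∪ A₂) ∪ ⁅ x ⁆ ∣ + ∣ B₁ ∩ B₂ ∣) < m + m
uncrossed-covers-size {m} x A₁ A₂ B₁ B₂ small₁ small₂ = begin-strict
  (∣ A₁ ∩ A₂ ∣ + ∣ B₁ ∪ B₂ ∣) + (∣ (A₁ ∪ A₂) ∪ ⁅ x ⁆ ∣ + ∣ B₁ ∩ B₂ ∣)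
    ≤⟨ +-monoʳ-≤ (∣ A₁ ∩ A₂ ∣ + ∣ B₁ ∪ B₂ ∣) (+-monoˡ-≤ (∣ B₁ ∩ B₂ ∣) (∣p∪⁅x⁆∣≤1+∣p∣ (A₁ ∪ A₂) x)) ⟩
  (∣ A₁ ∩ A₂ ∣ + ∣ B₁ ∪ B₂ ∣) + (suc ∣ A₁ ∪ A₂ ∣ + ∣ B₁ ∩ B₂ ∣)
    ≡⟨ shuffle (∣ A₁ ∩ A₂ ∣) (∣ B₁ ∪ B₂ ∣) (∣ A₁ ∪ A₂ ∣) (∣ B₁ ∩ B₂ ∣) ⟩
  suc ((∣ A₁ ∪ A₂ ∣ + ∣ A₁ ∩ A₂ ∣) + (∣ B₁ ∪ B₂ ∣ + ∣ B₁ ∩ B₂ ∣))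
    ≡⟨ cong₂ (λ a b → suc (a + b)) (∣p∪q∣+∣p∩q∣≡∣p∣+∣q∣ A₁ A₂) (∣p∪q∣+∣p∩q∣≡∣p∣+∣q∣ B₁ B₂) ⟩
  suc ((∣ A₁ ∣ + ∣ A₂ ∣) + (∣ B₁ ∣ + ∣ B₂ ∣))
    ≡⟨ cong suc (regroup (∣ A₁ ∣) (∣ A₂ ∣) (∣ B₁ ∣) (∣ B₂ ∣)) ⟩
  suc ((∣ A₁ ∣ + ∣ B₁ ∣) + (∣ A₂ ∣ + ∣ B₂ ∣))
    <⟨ subst (_≤ m + m) (cong suc (+-suc (∣ A₁ ∣ + ∣ B₁ ∣) (∣ A₂ ∣ + ∣ B₂ ∣))) (+-mono-≤ small₁ small₂) ⟩
  m + m ∎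
  where
  open ≤-Reasoning
  shuffle : ∀ i j u v → (i + j) + (suc u + v) ≡ suc ((u + i) + (j + v))
  shuffle = solve-∀
  regroup : ∀ a b c d → (a + b) + (c + d) ≡ (a + c) + (b + d)
  regroup = solve-∀

-- Rado's argument: if both deletions had small covers, neither containing x, their uncrossings
-- (A₁ ∩ A₂ , B₁ ∪ B₂) and (A₁ ∪ A₂ ∪ ⁅x⁆ , B₁ ∩ B₂) would cover N with total size below m + m.
deletableEdge : (N : BipartiteGraph m n) {x : Fin m} {y₁ y₂ : Fin n} → NoSmallCover N →
  y₁ ≢ y₂ → y₁ ∈ N x → y₂ ∈ N x → ∃ λ y → y ∈ N x × NoSmallCover (deleteEdge N x y)
deletableEdge N {x} {y₁} {y₂} none y₁≢y₂ y₁∈ y₂∈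
  with smallCover? (deleteEdge N x y₁) | smallCover? (deleteEdge N x y₂)
... | no none₁ | _        = y₁ , y₁∈ , none₁
... | yes _    | no none₂ = y₂ , y₂∈ , none₂
... | yes (A₁ , B₁ , cov₁ , small₁) | yes (A₂ , B₂ , cov₂ , small₂) with x ∈? A₁ | x ∈? A₂
...   | yes x∈A₁ | _        = ⊥-elim (none (A₁ , B₁ , covers-deleteEdge N cov₁ x∈A₁ , small₁))
...   | no _     | yes x∈A₂ = ⊥-elim (none (A₂ , B₂ , covers-deleteEdge N cov₂ x∈A₂ , small₂))
...   | no x∉A₁  | no x∉A₂ with +<+⇒<⊎< (uncrossed-covers-size x A₁ A₂ B₁ B₂ small₁ small₂)
...     | inj₁ small = ⊥-elim (none (_ , _ , covers-∩∪ N x∉A₁ x∉A₂ y₁≢y₂ cov₁ cov₂ , small))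
...     | inj₂ small = ⊥-elim (none (_ , _ , covers-∪∩ N cov₁ cov₂ , small))

AtMostOne : Subset n → Set
AtMostOne p = ∀ {y y′} → y ∈ p → y′ ∈ p → y ≡ y′

TwoElements : Subset n → Set
TwoElements p = ∃₂ λ y y′ → y ≢ y′ × y ∈ p × y′ ∈ p

twoElements? : (p : Subset n) → Dec (TwoElements p)
twoElements? p = any? λ y → any? λ y′ → ¬? (y ≟ y′) ×-dec y ∈? p ×-dec y′ ∈? p

¬twoElements⇒atMostOne : (p : Subset n) → ¬ TwoElements p → AtMostOne p
¬twoElements⇒atMostOne p ¬two {y} {y′} y∈ y′∈ with y ≟ y′
... | yes y≡y′ = y≡y′
... | no y≢y′ = ⊥-elim (¬two (y , y′ , y≢y′ , y∈ , y′∈))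

Thinning : BipartiteGraph m n → (BipartiteGraph m n → Set) → Set
Thinning N P = ∃ λ N′ → N′ ⊑ N × NoSmallCover N′ × P N′

thinRow : (bound : ℕ) (N : BipartiteGraph m n) (x : Fin m) → ∣ N x ∣ < bound → NoSmallCover N →
  Thinning N (λ N′ → AtMostOne (N′ x))
thinRow (suc bound) N x ∣Nx∣≤bound none with twoElements? (N x)
... | no ¬two = N , (λ _ y∈ → y∈) , none , ¬twoElements⇒atMostOne (N x) ¬two
... | yes (_ , _ , y₁≢y₂ , y₁∈ , y₂∈) with deletableEdge N none y₁≢y₂ y₁∈ y₂∈
...   | y , y∈ , none′ with thinRow bound (deleteEdge N x y) x (<-≤-trans (∣deleteEdge∣< N y∈) (s≤s⁻¹ ∣Nx∣≤bound)) none′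
...     | N′ , N′⊑ , none″ , atMostOne = N′ , (λ x′ y′∈ → deleteEdge-⊑ N x y x′ (N′⊑ x′ y′∈)) , none″ , atMostOne

thinRows : (xs : List (Fin m)) (N : BipartiteGraph m n) → NoSmallCover N →
  Thinning N (λ N′ → ∀ x → x ∈ₗ xs → AtMostOne (N′ x))
thinRows [] N none = N , (λ _ y∈ → y∈) , none , λ _ ()
thinRows (x ∷ xs) N none with thinRows xs N none
... | N₁ , N₁⊑N , none₁ , rows₁ with thinRow (suc ∣ N₁ x ∣) N₁ x (n<1+n _) none₁
...   | N₂ , N₂⊑N₁ , none₂ , row₂ = N₂ , (λ x′ y∈ → N₁⊑N x′ (N₂⊑N₁ x′ y∈)) , none₂ , rows₂
  where
  rows₂ : ∀ x′ → x′ ∈ₗ x ∷ xs → AtMostOne (N₂ x′)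
  rows₂ x′ (hereₗ refl) = row₂
  rows₂ x′ (thereₗ x′∈xs) y∈ y′∈ = rows₁ x′ x′∈xs (N₂⊑N₁ x′ y∈) (N₂⊑N₁ x′ y′∈)

nonempty-row : (N : BipartiteGraph m n) → NoSmallCover N → ∀ x → ∃ λ y → y ∈ N x
nonempty-row {m} {n} N none x with any? (λ y → y ∈? N x)
... | yes y∈ = y∈
... | no empty = ⊥-elim (none (∁ ⁅ x ⁆ , ∅ , cover , small))
  where
  cover : Covers N (∁ ⁅ x ⁆) ∅
  cover x′ y y∈ with x′ ≟ x
  ... | yes refl = ⊥-elim (empty (y , y∈))
  ... | no x′≢x = inj₁ (x∉p⇒x∈∁p (x≢y⇒x∉⁅y⁆ x′≢x))
  small : ∣ ∁ ⁅ x ⁆ ∣ + ∣ ∅ {n} ∣ < m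
  small rewrite ∣⊥∣≡0 n | +-identityʳ ∣ ∁ ⁅ x ⁆ ∣ = ∣∁⁅x⁆∣<n x

matching-injective : (N : BipartiteGraph m n) → NoSmallCover N → (∀ x → AtMostOne (N x)) →
  (f : Fin m → Fin n) → (∀ x → f x ∈ N x) → Injective _≡_ _≡_ f
matching-injective {m} N none atMostOne f f∈ {x} {x′} fx≡fx′ with x ≟ x′
... | yes x≡x′ = x≡x′
... | no x≢x′ = ⊥-elim (none (∁ ⁅ x ⁆ - x′ , ⁅ f x ⁆ , cover , small))
  where
  cover : Covers N (∁ ⁅ x ⁆ - x′) ⁅ f x ⁆
  cover x″ y y∈ with x″ ≟ x | x″ ≟ x′
  ... | yes refl | _ = inj₂ (subst (_∈ ⁅ f x ⁆) (atMostOne _ (f∈ _) y∈) (x∈⁅x⁆ (f x)))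
  ... | no _ | yes refl = inj₂ (subst (_∈ ⁅ f x ⁆) (trans fx≡fx′ (atMostOne _ (f∈ _) y∈)) (x∈⁅x⁆ (f x)))
  ... | no x″≢x | no x″≢x′ = inj₁ (x∈p∧x≢y⇒x∈p-y (x∉p⇒x∈∁p (x≢y⇒x∉⁅y⁆ x″≢x)) x″≢x′)
  small : ∣ ∁ ⁅ x ⁆ - x′ ∣ + ∣ ⁅ f x ⁆ ∣ < m
  small = begin-strict
    ∣ ∁ ⁅ x ⁆ - x′ ∣ + ∣ ⁅ f x ⁆ ∣ ≡⟨ cong (∣ ∁ ⁅ x ⁆ - x′ ∣ +_) (∣⁅x⁆∣≡1 (f x)) ⟩
    ∣ ∁ ⁅ x ⁆ - x′ ∣ + 1          ≡⟨ +-comm (∣ ∁ ⁅ x ⁆ - x′ ∣) 1 ⟩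
    suc ∣ ∁ ⁅ x ⁆ - x′ ∣          ≤⟨ x∈p⇒∣p-x∣<∣p∣ (x∉p⇒x∈∁p (x≢y⇒x∉⁅y⁆ (x≢x′ ∘ sym))) ⟩
    ∣ ∁ ⁅ x ⁆ ∣                   <⟨ ∣∁⁅x⁆∣<n x ⟩
    m                             ∎
    where open ≤-Reasoning

hall-könig : (N : BipartiteGraph m n) → NoSmallCover N →
  ∃ λ (f : Fin m → Fin n) → Injective _≡_ _≡_ f × (∀ x → f x ∈ N x)
hall-könig {m} N none with thinRows (allFin m) N none
... | N′ , N′⊑N , none′ , rows = f , matching-injective N′ none′ atMostOne f f∈ , λ x → N′⊑N x (f∈ x)
  where
  atMostOne : ∀ x → AtMostOne (N′ x)
  atMostOne x = rows x (∈-allFin x)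
  f : Fin m → Fin _
  f x = proj₁ (nonempty-row N′ none′ x)
  f∈ : ∀ x → f x ∈ N′ x
  f∈ x = proj₂ (nonempty-row N′ none′ x)

-- Colourings

SamePartition-sym : {c c′ : Colouring n k} → SamePartition c c′ → SamePartition c′ c
SamePartition-sym {c = c} (π , c′≡πc) = flip π , λ v → trans (sym (inverseˡ π)) (cong (π ⟨$⟩ˡ_) (sym (c′≡πc v)))

SamePartition-trans : {c c′ c″ : Colouring n k} → SamePartition c c′ → SamePartition c′ c″ → SamePartition c c″
SamePartition-trans (π , c′≡πc) (ρ , c″≡ρc′) = π ∘ₚ ρ , λ v → trans (c″≡ρc′ v) (cong (ρ ⟨$⟩ʳ_) (c′≡πc v))

Proper-∘ : (G : Graph n) {c : Colouring n k} {h : Fin k → Fin l} → Injective _≡_ _≡_ h → Proper G c → Proper G (h ∘ c)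
Proper-∘ G h-inj pc adj = pc adj ∘ h-inj

partner : (G : Graph n) → ExactlyTwoColourings G k → {c : Colouring n k} → Proper G c →
  ∃ λ d → Proper G d × ¬ SamePartition c d × (∀ c′ → Proper G c′ → SamePartition c c′ ⊎ SamePartition d c′)
partner G (c₁ , c₂ , pc₁ , pc₂ , c₁≉c₂ , classes) pc with classes _ pc
... | inj₁ c₁≈c = c₂ , pc₂ , (c₁≉c₂ ∘ SamePartition-trans c₁≈c) ,
  λ c′ pc′ → map₁ (SamePartition-trans (SamePartition-sym c₁≈c)) (classes c′ pc′)
... | inj₂ c₂≈c = c₁ , pc₁ , (c₁≉c₂ ∘ SamePartition-sym ∘ SamePartition-trans c₂≈c) ,
  λ c′ pc′ → swap (map₂ (SamePartition-trans (SamePartition-sym c₂≈c)) (classes c′ pc′))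

meets? : (c : Colouring n k) (d : Colouring n l) (x : Fin k) → Decidable (λ y → ∃ λ v → c v ≡ x × d v ≡ y)
meets? c d x y = any? λ v → c v ≟ x ×-dec d v ≟ y

meetGraph : Colouring n k → Colouring n l → BipartiteGraph k l
meetGraph c d x = select (meets? c d x)

cover⇒colouring : (G : Graph n) {c : Colouring n k} {d : Colouring n l} {A : Subset k} {B : Subset l} →
  Proper G c → Proper G d → Covers (meetGraph c d) A B → Colourable G (∣ A ∣ + ∣ B ∣)
cover⇒colouring G {c} {d} {A} {B} pc pd cover = join ∣ A ∣ ∣ B ∣ ∘ label ∘ side , proper
  where
  side : ∀ v → c v ∈ A ⊎ d v ∈ B
  side v = cover (c v) (d v) (∈-select⁺ (meets? c d (c v)) (v , refl , refl))
  label : ∀ {v} → c v ∈ A ⊎ d v ∈ B → Fin ∣ A ∣ ⊎ Fin ∣ B ∣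
  label = map index index
  label-distinct : ∀ {u w} → Adj G u w → (su : c u ∈ A ⊎ d u ∈ B) (sw : c w ∈ A ⊎ d w ∈ B) → label su ≢ label sw
  label-distinct adj (inj₁ cu∈A) (inj₁ cw∈A) eq = pc adj (index-injective cu∈A cw∈A (inj₁-injective eq))
  label-distinct adj (inj₂ du∈B) (inj₂ dw∈B) eq = pd adj (index-injective du∈B dw∈B (inj₂-injective eq))
  label-distinct adj (inj₁ _) (inj₂ _) ()
  label-distinct adj (inj₂ _) (inj₁ _) ()
  join-injective : Injective _≡_ _≡_ (join ∣ A ∣ ∣ B ∣)
  join-injective {i} {j} eq = trans (sym (splitAt-join _ _ i)) (trans (cong (splitAt ∣ A ∣) eq) (splitAt-join _ _ j))
  proper : Proper G (join ∣ A ∣ ∣ B ∣ ∘ label ∘ side)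
  proper adj = label-distinct adj (side _) (side _) ∘ join-injective

meetGraph-noSmallCover : (G : Graph n) → (∀ j → j < k → ¬ Colourable G j) →
  {c : Colouring n k} {d : Colouring n l} → Proper G c → Proper G d → NoSmallCover (meetGraph c d)
meetGraph-noSmallCover G χ-minimal pc pd (A , B , cover , small) = χ-minimal _ small (cover⇒colouring G pc pd cover)

-- Determining and critical sets

Essential : Graph n → Colouring n k → Subset n → Fin n → Set
Essential {n} {k} G c S u =
  ∃ λ (c′ : Colouring n k) → Proper G c′ × (∀ v → v ∈ S → v ≢ u → c′ v ≡ c v) × c′ u ≢ c u

essential⇒critical : (G : Graph n) {c : Colouring n k} {S : Subset n} →
  Determining G c S → (∀ u → u ∈ S → Essential G c S u) → Critical G c S
essential⇒critical G determining essential = determining , minimal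
  where
  minimal : ∀ T → T ⊂ _ → ¬ Determining G _ T
  minimal T (T⊆S , u , u∈S , u∉T) T-determining with essential u u∈S
  ... | c′ , pc′ , agrees , differs =
    differs (T-determining c′ pc′ (λ v v∈T → agrees v (T⊆S v∈T) (λ { refl → u∉T v∈T })) u)

module CriticalSetConstruction
  {n k} (G : Graph n) (χ-minimal : ∀ j → j < k → ¬ Colourable G j)
  {c d : Colouring n k} (pc : Proper G c) (pd : Proper G d) (c≉d : ¬ SamePartition c d)
  (classes : ∀ c′ → Proper G c′ → SamePartition c c′ ⊎ SamePartition d c′)
  where

  private
    matching : ∃ λ (f : Fin k → Fin k) → Injective _≡_ _≡_ f × (∀ x → f x ∈ meetGraph c d x)
    matching = hall-könig (meetGraph c d) (meetGraph-noSmallCover G χ-minimal pc pd)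

  f : Fin k → Fin k
  f = proj₁ matching

  f-injective : Injective _≡_ _≡_ f
  f-injective = proj₁ (proj₂ matching)

  σ : Permutation′ k
  σ = injection⇒permutation f f-injective

  representative : ∀ x → ∃ λ v → c v ≡ x × d v ≡ f x
  representative x = ∈-select⁻ (meets? c d x) (proj₂ (proj₂ matching) x)

  mismatch : ∃ λ v → d v ≢ f (c v)
  mismatch = ¬∀⟶∃¬ n _ (λ v → d v ≟ f (c v)) (λ d≡fc → c≉d (σ , d≡fc))

  v₀ : Fin n
  v₀ = proj₁ mismatch

  y w : Fin k
  y = σ ⟨$⟩ˡ d v₀
  w = c v₀

  y≢w : y ≢ w
  y≢w y≡w = proj₂ mismatch (trans (sym (inverseʳ σ)) (cong f y≡w))

  s : Fin k → Fin n
  s x with x ≟ y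
  ... | yes _ = v₀
  ... | no _ = proj₁ (representative x)

  d∘s : ∀ x → d (s x) ≡ f x
  d∘s x with x ≟ y
  ... | yes refl = sym (inverseʳ σ)
  ... | no _ = proj₂ (proj₂ (representative x))

  c∘s : ∀ x → x ≢ y → c (s x) ≡ x
  c∘s x x≢y with x ≟ y
  ... | yes x≡y = ⊥-elim (x≢y x≡y)
  ... | no _ = proj₁ (proj₂ (representative x))

  c∘s-y : c (s y) ≡ w
  c∘s-y with y ≟ y
  ... | yes _ = refl
  ... | no y≢y = ⊥-elim (y≢y refl)

  σ⁻¹∘d∘s : ∀ x → σ ⟨$⟩ˡ d (s x) ≡ x
  σ⁻¹∘d∘s x = trans (cong (σ ⟨$⟩ˡ_) (d∘s x)) (inverseˡ σ)

  s-injective : Injective _≡_ _≡_ s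
  s-injective {x} {x′} eq = f-injective (trans (sym (d∘s x)) (trans (cong d eq) (d∘s x′)))

  S : Subset n
  S = image s

  ∣S∣≡k : ∣ S ∣ ≡ k
  ∣S∣≡k = injective⇒∣image∣≡m s-injective

  S-determining : Determining G c S
  S-determining c′ pc′ agree with classes c′ pc′
  ... | inj₁ (π , c′≡πc) = λ v → trans (c′≡πc v) (fixes-all-but-one⇒fixes-all π y π-fixes (c v))
    where
    π-fixes : ∀ x → x ≢ y → π ⟨$⟩ʳ x ≡ x
    π-fixes x x≢y = begin
      π ⟨$⟩ʳ x       ≡⟨ cong (π ⟨$⟩ʳ_) (c∘s x x≢y) ⟨
      π ⟨$⟩ʳ c (s x) ≡⟨ c′≡πc (s x) ⟨
      c′ (s x)       ≡⟨ agree (s x) (∈-image⁺ s x) ⟩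
      c (s x)        ≡⟨ c∘s x x≢y ⟩
      x              ∎
      where open ≡-Reasoning
  ... | inj₂ (π , c′≡πd) = ⊥-elim (y≢w (f-injective (permutation-injective π (begin
      π ⟨$⟩ʳ f y     ≡⟨ cong (π ⟨$⟩ʳ_) (d∘s y) ⟨
      π ⟨$⟩ʳ d (s y) ≡⟨ c′≡πd (s y) ⟨
      c′ (s y)       ≡⟨ agree (s y) (∈-image⁺ s y) ⟩
      c (s y)        ≡⟨ c∘s-y ⟩
      w              ≡⟨ c∘s w (y≢w ∘ sym) ⟨
      c (s w)        ≡⟨ agree (s w) (∈-image⁺ s w) ⟨
      c′ (s w)       ≡⟨ c′≡πd (s w) ⟩
      π ⟨$⟩ʳ d (s w) ≡⟨ cong (π ⟨$⟩ʳ_) (d∘s w) ⟩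
      π ⟨$⟩ʳ f w     ∎))))
    where open ≡-Reasoning

  essential-at : ∀ z (c′ : Colouring n k) → Proper G c′ →
    (∀ x → x ≢ z → c′ (s x) ≡ c (s x)) → c′ (s z) ≢ c (s z) → Essential G c S (s z)
  essential-at z c′ pc′ agrees differs = c′ , pc′ , agrees-on-S , differs
    where
    agrees-on-S : ∀ v → v ∈ S → v ≢ s z → c′ v ≡ c v
    agrees-on-S v v∈S v≢sz with ∈-image⁻ s v∈S
    ... | x , refl = agrees x (v≢sz ∘ cong s)

  essential-y : Essential G c S (s y)
  essential-y = essential-at y ((σ ⟨$⟩ˡ_) ∘ d) (Proper-∘ G (permutation-injective (flip σ)) pd)
    (λ x x≢y → trans (σ⁻¹∘d∘s x) (sym (c∘s x x≢y)))
    (λ eq → y≢w (trans (sym (σ⁻¹∘d∘s y)) (trans eq c∘s-y)))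

  -- Case splits on x ≟ y take a Dec argument, since a with would also abstract the test inside s x.
  essential-w : Essential G c S (s w)
  essential-w = essential-at w ((τ ⟨$⟩ʳ_) ∘ (σ ⟨$⟩ˡ_) ∘ d)
    (Proper-∘ G (permutation-injective τ) (Proper-∘ G (permutation-injective (flip σ)) pd))
    agrees
    (λ eq → y≢w (trans (sym moved) (trans eq (c∘s w (y≢w ∘ sym)))))
    where
    τ : Permutation′ k
    τ = transpose y w
    moved : τ ⟨$⟩ʳ (σ ⟨$⟩ˡ d (s w)) ≡ y
    moved = trans (cong (τ ⟨$⟩ʳ_) (σ⁻¹∘d∘s w)) (transpose-matchʳ y w)
    agrees : ∀ x → x ≢ w → τ ⟨$⟩ʳ (σ ⟨$⟩ˡ d (s x)) ≡ c (s x)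
    agrees x x≢w = by-cases (x ≟ y)
      where
      by-cases : Dec (x ≡ y) → τ ⟨$⟩ʳ (σ ⟨$⟩ˡ d (s x)) ≡ c (s x)
      by-cases (yes refl) = trans (cong (τ ⟨$⟩ʳ_) (σ⁻¹∘d∘s y)) (trans (transpose-matchˡ y w) (sym c∘s-y))
      by-cases (no x≢y) = trans (cong (τ ⟨$⟩ʳ_) (σ⁻¹∘d∘s x)) (trans (transpose-other x≢y x≢w) (sym (c∘s x x≢y)))

  essential-other : ∀ z → z ≢ y → z ≢ w → Essential G c S (s z)
  essential-other z z≢y z≢w = essential-at z ((τ ⟨$⟩ʳ_) ∘ c) (Proper-∘ G (permutation-injective τ) pc)
    agrees
    (λ eq → z≢y (sym (trans (sym moved) (trans eq (c∘s z z≢y)))))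
    where
    τ : Permutation′ k
    τ = transpose z y
    moved : τ ⟨$⟩ʳ c (s z) ≡ y
    moved = trans (cong (τ ⟨$⟩ʳ_) (c∘s z z≢y)) (transpose-matchˡ z y)
    agrees : ∀ x → x ≢ z → τ ⟨$⟩ʳ c (s x) ≡ c (s x)
    agrees x x≢z = by-cases (x ≟ y)
      where
      by-cases : Dec (x ≡ y) → τ ⟨$⟩ʳ c (s x) ≡ c (s x)
      by-cases (yes refl) = trans (cong (τ ⟨$⟩ʳ_) c∘s-y) (trans (transpose-other (z≢w ∘ sym) (y≢w ∘ sym)) (sym c∘s-y))
      by-cases (no x≢y) = trans (cong (τ ⟨$⟩ʳ_) (c∘s x x≢y)) (trans (transpose-other x≢z x≢y) (sym (c∘s x x≢y)))

  essential-s : ∀ z → Dec (z ≡ y) → Dec (z ≡ w) → Essential G c S (s z)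
  essential-s z (yes refl) _ = essential-y
  essential-s z (no _) (yes refl) = essential-w
  essential-s z (no z≢y) (no z≢w) = essential-other z z≢y z≢w

  essential : ∀ u → u ∈ S → Essential G c S u
  essential u u∈S with ∈-image⁻ s u∈S
  ... | z , refl = essential-s z (z ≟ y) (z ≟ w)

  S-critical : Critical G c S
  S-critical = essential⇒critical G S-determining essential

mainTheorem18 : ∀ {n k} (G : Graph n) → IsChromaticNumber G k →
    ExactlyTwoColourings G k →
    ∀ (c : Colouring n k) → Proper G c →
    Σ (Subset n) λ S → Critical G c S × ∣ S ∣ ≡ k
mainTheorem18 G (_ , χ-minimal) two c pc with partner G two pc
... | d , pd , c≉d , classes = S , S-critical , ∣S∣≡k
  where open CriticalSetConstruction G χ-minimal pc pd c≉d classes
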